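{- Let $D$ be the derivation on $\mathbb{Q}[a,b,x,y,z]$ determined by $$D(a)=az,\quad D(b)=xy,\quad D(x)=xy,\quad D(y)=xy,\quad D(z)=xy$$ (extended by linearity and the Leibniz rule). For $n\ge 1$ let $$R_n(x,y,z)=\sum_{\sigma\in S_n} x^{\mathrm{jump}(\sigma)} y^{\mathrm{des}(\sigma)} z^{\mathrm{suc}(\sigma)}.$$ Then for every $n\ge 1$, $$R_n(x,y,z)=D^{n-1}(ab)\big|_{a=1,\,b=1}.$$
   Context: $S_n$ is the set of permutations $\sigma=\sigma_1\cdots\sigma_n$ of $[n]$, with $\sigma_0=0$. $\mathrm{jump}(\sigma)$ is the number of indices $1\le i\le n$ with $\sigma_i\ge\sigma_{i-1}+2$; $\mathrm{des}(\sigma)$ is the number of indices $1\le i\le n-1$ with $\sigma_i>\sigma_{i+1}$; $\mathrm{suc}(\sigma)$ is the number of indices $1\le i\le n-1$ with $\sigma_i+1=\sigma_{i+1}$ (interior successions). -}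

module Defs where

open import Data.Nat as ℕ using (ℕ; zero; suc; _∸_; _≤?_; _≟_)
open import Data.Bool using (Bool; true; false; if_then_else_)
open import Data.Product using (_×_; _,_)
open import Data.List using (List; []; _∷_; _++_; map; concatMap; filter; upTo; length; foldr)
open import Data.Rational using (ℚ; 0ℚ; 1ℚ; _+_; _*_)
open import Data.Integer using (+_)
open import Relation.Nullary.Decidable using (does)
open import Data.List.Relation.Unary.Unique.DecPropositional _≟_ using (unique?)
import Data.Rational as Q

-- Polynomials in ℚ[a,b,x,y,z], represented as finite lists of terms
-- (coefficient, monomial).  A monomial a^i b^j x^k y^l z^m is the
-- exponent tuple (i , j , k , l , m).  Two term lists denote the same
-- polynomial iff they have the same coefficient at every monomial
-- (see `coeff`).

Mono : Set
Mono = ℕ × ℕ × ℕ × ℕ × ℕ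

Poly : Set
Poly = List (ℚ × Mono)

ℕ→ℚ : ℕ → ℚ
ℕ→ℚ n = (+ n) Q./ 1

eqℕ : ℕ → ℕ → Bool
eqℕ m n = does (m ≟ n)

_∧_ : Bool → Bool → Bool
true ∧ b = b
false ∧ _ = false

eqMono : Mono → Mono → Bool
eqMono (i , j , k , l , m) (i' , j' , k' , l' , m') =
  eqℕ i i' ∧ (eqℕ j j' ∧ (eqℕ k k' ∧ (eqℕ l l' ∧ eqℕ m m')))

coeff : Poly → Mono → ℚ
coeff [] μ = 0ℚ
coeff ((c , ν) ∷ p) μ = (if eqMono ν μ then c else 0ℚ) + coeff p μ

_⊕_ : Poly → Poly → Poly
p ⊕ q = p ++ q

mulMono : Mono → Mono → Mono
mulMono (i , j , k , l , m) (i' , j' , k' , l' , m') =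
  (i ℕ.+ i' , j ℕ.+ j' , k ℕ.+ k' , l ℕ.+ l' , m ℕ.+ m')

_⊗_ : Poly → Poly → Poly
p ⊗ q = concatMap (λ { (c , μ) → map (λ { (d , ν) → (c * d , mulMono μ ν) }) q }) p

var-a var-b var-x var-y var-z : Poly
var-a = (1ℚ , (1 , 0 , 0 , 0 , 0)) ∷ []
var-b = (1ℚ , (0 , 1 , 0 , 0 , 0)) ∷ []
var-x = (1ℚ , (0 , 0 , 1 , 0 , 0)) ∷ []
var-y = (1ℚ , (0 , 0 , 0 , 1 , 0)) ∷ []
var-z = (1ℚ , (0 , 0 , 0 , 0 , 1)) ∷ []

∂a ∂b ∂x ∂y ∂z : Poly → Poly
∂a = map λ { (c , (i , j , k , l , m)) → (ℕ→ℚ i * c , (i ∸ 1 , j , k , l , m)) }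
∂b = map λ { (c , (i , j , k , l , m)) → (ℕ→ℚ j * c , (i , j ∸ 1 , k , l , m)) }
∂x = map λ { (c , (i , j , k , l , m)) → (ℕ→ℚ k * c , (i , j , k ∸ 1 , l , m)) }
∂y = map λ { (c , (i , j , k , l , m)) → (ℕ→ℚ l * c , (i , j , k , l ∸ 1 , m)) }
∂z = map λ { (c , (i , j , k , l , m)) → (ℕ→ℚ m * c , (i , j , k , l , m ∸ 1)) }

-- The unique derivation with D(a)=az, D(b)=D(x)=D(y)=D(z)=xy:
-- D p = Σ_v D(v) · ∂p/∂v  (linearity + Leibniz rule).
D : Poly → Poly
D p = ((var-a ⊗ var-z) ⊗ ∂a p)
    ⊕ (((var-x ⊗ var-y) ⊗ ∂b p)
    ⊕ (((var-x ⊗ var-y) ⊗ ∂x p)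
    ⊕ (((var-x ⊗ var-y) ⊗ ∂y p)
    ⊕ ((var-x ⊗ var-y) ⊗ ∂z p))))

iterate : {A : Set} → (A → A) → ℕ → A → A
iterate f zero a = a
iterate f (suc n) a = f (iterate f n a)

Mono3 : Set
Mono3 = ℕ × ℕ × ℕ

Poly3 : Set
Poly3 = List (ℚ × Mono3)

eqMono3 : Mono3 → Mono3 → Bool
eqMono3 (k , l , m) (k' , l' , m') = eqℕ k k' ∧ (eqℕ l l' ∧ eqℕ m m')

coeff3 : Poly3 → Mono3 → ℚ
coeff3 [] μ = 0ℚ
coeff3 ((c , ν) ∷ p) μ = (if eqMono3 ν μ then c else 0ℚ) + coeff3 p μ

eval-a1b1 : Poly → Poly3
eval-a1b1 = map λ { (c , (i , j , k , l , m)) → (c , (k , l , m)) }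

words : ℕ → ℕ → List (List ℕ)
words zero n = [] ∷ []
words (suc k) n = concatMap (λ w → map (λ i → suc i ∷ w) (upTo n)) (words k n)

S : ℕ → List (List ℕ)
S n = filter unique? (words n n)

adjPairs : List ℕ → List (ℕ × ℕ)
adjPairs [] = []
adjPairs (u ∷ []) = []
adjPairs (u ∷ v ∷ w) = (u , v) ∷ adjPairs (v ∷ w)

countPairs : (ℕ → ℕ → Bool) → List (ℕ × ℕ) → ℕ
countPairs P [] = 0
countPairs P ((u , v) ∷ ps) = (if P u v then 1 else 0) ℕ.+ countPairs P ps

-- jump: indices 1 ≤ i ≤ n with σᵢ ≥ σᵢ₋₁ + 2, where σ₀ = 0
jump : List ℕ → ℕ
jump σ = countPairs (λ u v → does (suc (suc u) ≤? v)) (adjPairs (0 ∷ σ))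

des : List ℕ → ℕ
des σ = countPairs (λ u v → does (suc v ≤? u)) (adjPairs σ)

sucs : List ℕ → ℕ
sucs σ = countPairs (λ u v → eqℕ (suc u) v) (adjPairs σ)

R : ℕ → Poly3
R n = map (λ σ → (1ℚ , (jump σ , des σ , sucs σ))) (S n)

module Submission where

-- Give σ ∈ S_n the weight a b^[σ₁ = 1] x^jump(σ) y^des(σ) z^suc(σ); we show that D^(n-1)(ab) is the sum
-- of these weights, which gives the theorem at a = b = 1.  Every σ ∈ S_(n+1) arises exactly once by
-- inserting n+1 into a slot of some σ' ∈ S_n, and the change of the statistics depends only on the slot.
-- Inserting into a jump adds a descent, into a descent adds a jump, and into a succession trades it for
-- a jump and a descent: these are the terms D(x) = D(y) = D(z) = xy of the Leibniz rule.  Inserting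
-- right after n creates a succession (D(a) = az), and the slot at the end then replaces the descent
-- leaving n.  The front slot lies inside the pair 0σ'₁, a jump or the succession 0,1 recorded by b
-- (D(b) = xy).  Polynomials are compared through an arbitrary weight g on monomials, which moves D to
-- its transpose Dᵀ acting on g.

open import Defs
open import Algebra.Bundles using (CommutativeMonoid)
open import Data.Bool using (Bool; true; false; if_then_else_)
open import Data.Empty using (⊥; ⊥-elim)
import Data.Integer as ℤ
import Data.Integer.Properties as ℤₚ
open import Data.List using (List; []; _∷_; _++_; map; concatMap; foldr; length; upTo)
open import Data.List.Properties using (map-∘)
open import Data.Nat as ℕ using (ℕ; zero; suc; _∸_; _≤_; _<_; _≤?_; _≟_; z≤n; s≤s)
import Data.Nat.Coprimality as Coprime
import Data.Nat.Properties as ℕₚ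
open import Data.List.Membership.DecPropositional _≟_ using (_∈?_)
open import Data.List.Membership.Propositional using (_∈_; _∉_; find; lose)
open import Data.List.Membership.Propositional.Properties
  using (∈-map⁺; ∈-map⁻; ∈-concatMap⁺; ∈-concatMap⁻; ∈-∃++; ∈-upTo⁺; ∈-upTo⁻; ∈-filter⁺; ∈-filter⁻)
open import Data.List.Membership.Propositional.Properties.WithK using (unique∧set⇒bag)
open import Data.List.Relation.Binary.BagAndSetEquality using (∼bag⇒↭)
open import Data.List.Relation.Binary.Permutation.Propositional as ↭ using (_↭_; ↭-sym; ↭⇒↭ₛ)
import Data.List.Relation.Binary.Permutation.Propositional.Properties as ↭ₚ
import Data.List.Relation.Binary.Permutation.Setoid.Properties as ↭ₛ
open import Data.List.Relation.Unary.All as All using (All; []; _∷_)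
open import Data.List.Relation.Unary.All.Properties using (All¬⇒¬Any; ¬Any⇒All¬)
import Data.List.Relation.Unary.All.Properties as Allₚ
open import Data.List.Relation.Unary.AllPairs using ([]; _∷_)
open import Data.List.Relation.Unary.Any using (here; there)
open import Data.List.Relation.Unary.Unique.DecPropositional _≟_ using (unique?)
open import Data.List.Relation.Unary.Unique.Propositional using (Unique)
import Data.List.Relation.Unary.Unique.Propositional.Properties as Unique
open import Data.Product using (_×_; _,_; ∃; proj₂)
open import Data.Rational using (ℚ; 0ℚ; 1ℚ; _+_; _*_; mkℚ)
open import Data.Rational.Properties
  using (*-identityˡ; *-identityʳ; *-zeroˡ; *-zeroʳ; +-identityˡ; +-assoc; +-0-isCommutativeMonoid; +-0-commutativeMonoid;
         normalize-coprime; toℚᵘ-injective; toℚᵘ-homo-+)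
open import Data.Rational.Solver using (module +-*-Solver)
open +-*-Solver using (solve; _:+_; _:*_; _:=_; con)
import Data.Rational.Unnormalised as ℚᵘ
import Data.Rational.Unnormalised.Properties as ℚᵘ
open import Algebra.Properties.CommutativeSemigroup (CommutativeMonoid.commutativeSemigroup +-0-commutativeMonoid)
  using (x∙yz≈y∙xz)
open import Function using (_∘_)
open import Function.Bundles using (mk⇔)
open import Relation.Binary.Definitions using (tri<; tri≈; tri>)
open import Relation.Binary.PropositionalEquality
open import Relation.Nullary using (yes; no)
open import Relation.Nullary.Decidable using (does; dec-true; dec-false)

∑ : {A : Set} → (A → ℚ) → List A → ℚ
∑ f xs = foldr _+_ 0ℚ (map f xs)

∑-++ : {A : Set} (f : A → ℚ) (xs ys : List A) → ∑ f (xs ++ ys) ≡ ∑ f xs + ∑ f ys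
∑-++ f []       ys = sym (+-identityˡ _)
∑-++ f (x ∷ xs) ys = trans (cong (f x +_) (∑-++ f xs ys)) (sym (+-assoc (f x) _ _))

∑-concatMap : {A B : Set} (f : B → ℚ) (g : A → List B) (xs : List A) →
              ∑ f (concatMap g xs) ≡ ∑ (λ x → ∑ f (g x)) xs
∑-concatMap f g []       = refl
∑-concatMap f g (x ∷ xs) = trans (∑-++ f (g x) (concatMap g xs)) (cong (∑ f (g x) +_) (∑-concatMap f g xs))

∑-cong : {A : Set} {f g : A → ℚ} (xs : List A) → (∀ {x} → x ∈ xs → f x ≡ g x) → ∑ f xs ≡ ∑ g xs
∑-cong []       _  = refl
∑-cong (x ∷ xs) eq = cong₂ _+_ (eq (here refl)) (∑-cong xs (eq ∘ there))

∑-↭ : {A : Set} (f : A → ℚ) {xs ys : List A} → xs ↭ ys → ∑ f xs ≡ ∑ f ys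
∑-↭ f p = ↭ₛ.foldr-commMonoid (setoid ℚ) +-0-isCommutativeMonoid (↭⇒↭ₛ (↭ₚ.map⁺ f p))

∑-sameElements : {A : Set} (f : A → ℚ) {xs ys : List A} → Unique xs → Unique ys →
                 (∀ {z} → z ∈ xs → z ∈ ys) → (∀ {z} → z ∈ ys → z ∈ xs) → ∑ f xs ≡ ∑ f ys
∑-sameElements f uxs uys to from = ∑-↭ f (∼bag⇒↭ (unique∧set⇒bag uxs uys (mk⇔ to from)))

∑-map : {A B : Set} (f : B → ℚ) (g : A → B) (xs : List A) → ∑ f (map g xs) ≡ ∑ (λ x → f (g x)) xs
∑-map f g xs = cong (foldr _+_ 0ℚ) (sym (map-∘ xs))

weighted : (Mono → ℚ) → ℚ × Mono → ℚ
weighted g (c , ν) = c * g ν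

⟦_⟧ : (Mono → ℚ) → Poly → ℚ
⟦ g ⟧ = ∑ (weighted g)

if-then-0 : (b : Bool) (c : ℚ) → (if b then c else 0ℚ) ≡ c * (if b then 1ℚ else 0ℚ)
if-then-0 true  c = sym (*-identityʳ c)
if-then-0 false c = sym (*-zeroʳ c)

δ-xyz : Mono3 → Mono → ℚ
δ-xyz μ (_ , _ , k , l , m) = if eqMono3 (k , l , m) μ then 1ℚ else 0ℚ

coeff3-eval-a1b1 : ∀ p μ → coeff3 (eval-a1b1 p) μ ≡ ⟦ δ-xyz μ ⟧ p
coeff3-eval-a1b1 []                          μ = refl
coeff3-eval-a1b1 ((c , (_ , _ , k , l , m)) ∷ p) μ =
  cong₂ _+_ (if-then-0 (eqMono3 (k , l , m) μ) c) (coeff3-eval-a1b1 p μ)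

-- When an exponent is 0 its truncated decrement gives a junk monomial, which the factor 0 discards.
Dᵀ : (Mono → ℚ) → Mono → ℚ
Dᵀ g (i , j , k , l , m) =
    ℕ→ℚ i * g (suc (i ∸ 1) , j , k , l , suc m)
  + (ℕ→ℚ j * g (i , j ∸ 1 , suc k , suc l , m)
  + (ℕ→ℚ k * g (i , j , suc (k ∸ 1) , suc l , m)
  + (ℕ→ℚ l * g (i , j , suc k , suc (l ∸ 1) , m)
  +  ℕ→ℚ m * g (i , j , suc k , suc l , m ∸ 1))))

private
  xy : Poly
  xy = var-x ⊗ var-y

⟦⟧-D-split : ∀ g p → ⟦ g ⟧ (D p) ≡
    ⟦ g ⟧ ((var-a ⊗ var-z) ⊗ ∂a p)
  + (⟦ g ⟧ (xy ⊗ ∂b p) + (⟦ g ⟧ (xy ⊗ ∂x p) + (⟦ g ⟧ (xy ⊗ ∂y p) + ⟦ g ⟧ (xy ⊗ ∂z p))))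
⟦⟧-D-split g p =
  trans (∑-++ (weighted g) ((var-a ⊗ var-z) ⊗ ∂a p) _) (cong (⟦ g ⟧ ((var-a ⊗ var-z) ⊗ ∂a p) +_)
  (trans (∑-++ (weighted g) (xy ⊗ ∂b p) _) (cong (⟦ g ⟧ (xy ⊗ ∂b p) +_)
  (trans (∑-++ (weighted g) (xy ⊗ ∂x p) _) (cong (⟦ g ⟧ (xy ⊗ ∂x p) +_)
  (∑-++ (weighted g) (xy ⊗ ∂y p) _))))))

⟦⟧-D-∷ : ∀ g c ν p → ⟦ g ⟧ (D ((c , ν) ∷ p)) ≡ c * Dᵀ g ν + ⟦ g ⟧ (D p)
⟦⟧-D-∷ g c ν@(i , j , k , l , m) p =
  trans (⟦⟧-D-split g ((c , ν) ∷ p))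
  (trans (regroup c (ℕ→ℚ i) (ℕ→ℚ j) (ℕ→ℚ k) (ℕ→ℚ l) (ℕ→ℚ m)
           (g (suc (i ∸ 1) , j , k , l , suc m)) (g (i , j ∸ 1 , suc k , suc l , m))
           (g (i , j , suc (k ∸ 1) , suc l , m)) (g (i , j , suc k , suc (l ∸ 1) , m))
           (g (i , j , suc k , suc l , m ∸ 1))
           (⟦ g ⟧ ((var-a ⊗ var-z) ⊗ ∂a p)) (⟦ g ⟧ (xy ⊗ ∂b p)) (⟦ g ⟧ (xy ⊗ ∂x p))
           (⟦ g ⟧ (xy ⊗ ∂y p)) (⟦ g ⟧ (xy ⊗ ∂z p)))
  (cong (c * Dᵀ g ν +_) (sym (⟦⟧-D-split g p))))
  where
  regroup : ∀ c e₁ e₂ e₃ e₄ e₅ g₁ g₂ g₃ g₄ g₅ r₁ r₂ r₃ r₄ r₅ →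
      (1ℚ * (e₁ * c) * g₁ + r₁) + ((1ℚ * (e₂ * c) * g₂ + r₂) + ((1ℚ * (e₃ * c) * g₃ + r₃)
        + ((1ℚ * (e₄ * c) * g₄ + r₄) + (1ℚ * (e₅ * c) * g₅ + r₅))))
    ≡ c * (e₁ * g₁ + (e₂ * g₂ + (e₃ * g₃ + (e₄ * g₄ + e₅ * g₅)))) + (r₁ + (r₂ + (r₃ + (r₄ + r₅))))
  regroup = solve 16 (λ c e₁ e₂ e₃ e₄ e₅ g₁ g₂ g₃ g₄ g₅ r₁ r₂ r₃ r₄ r₅ →
      (con 1ℚ :* (e₁ :* c) :* g₁ :+ r₁) :+ ((con 1ℚ :* (e₂ :* c) :* g₂ :+ r₂) :+ ((con 1ℚ :* (e₃ :* c) :* g₃ :+ r₃)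
        :+ ((con 1ℚ :* (e₄ :* c) :* g₄ :+ r₄) :+ (con 1ℚ :* (e₅ :* c) :* g₅ :+ r₅))))
    := c :* (e₁ :* g₁ :+ (e₂ :* g₂ :+ (e₃ :* g₃ :+ (e₄ :* g₄ :+ e₅ :* g₅)))) :+ (r₁ :+ (r₂ :+ (r₃ :+ (r₄ :+ r₅))))) refl

⟦⟧-D : ∀ g p → ⟦ g ⟧ (D p) ≡ ⟦ Dᵀ g ⟧ p
⟦⟧-D g []            = refl
⟦⟧-D g ((c , ν) ∷ p) = trans (⟦⟧-D-∷ g c ν p) (cong (c * Dᵀ g ν +_) (⟦⟧-D g p))

isJump isDescent isSuccession : ℕ → ℕ → Bool
isJump      u v = does (suc (suc u) ≤? v)
isDescent   u v = does (suc v ≤? u)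
isSuccession u v = eqℕ (suc u) v

#jumps #descents #successions : List ℕ → ℕ
#jumps       w = countPairs isJump       (adjPairs w)
#descents    w = countPairs isDescent    (adjPairs w)
#successions w = countPairs isSuccession (adjPairs w)

indicator : Bool → ℕ
indicator b = if b then 1 else 0

pairType : ℕ → ℕ → ℕ × ℕ × ℕ
pairType u v = indicator (isJump u v) , indicator (isDescent u v) , indicator (isSuccession u v)

data OneHot : ℕ × ℕ × ℕ → Set where
  jumpᵒ       : OneHot (1 , 0 , 0)
  descentᵒ    : OneHot (0 , 1 , 0)
  successionᵒ : OneHot (0 , 0 , 1)

pairType-jump : ∀ {u v} → suc u < v → pairType u v ≡ (1 , 0 , 0)
pairType-jump {u} {v} 1+u<v
  rewrite dec-true  (suc (suc u) ≤? v) 1+u<v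
        | dec-false (suc v ≤? u) (λ v<u → ℕₚ.<-asym (ℕₚ.<-trans (ℕₚ.n<1+n u) 1+u<v) v<u)
        | dec-false (suc u ≟ v) (λ 1+u≡v → ℕₚ.<-irrefl 1+u≡v 1+u<v) = refl

pairType-descent : ∀ {u v} → v < u → pairType u v ≡ (0 , 1 , 0)
pairType-descent {u} {v} v<u
  rewrite dec-false (suc (suc u) ≤? v) (λ 1+u<v → ℕₚ.<-asym v<u (ℕₚ.<-trans (ℕₚ.n<1+n u) 1+u<v))
        | dec-true  (suc v ≤? u) v<u
        | dec-false (suc u ≟ v) (λ 1+u≡v → ℕₚ.<-asym v<u (subst (u <_) 1+u≡v (ℕₚ.n<1+n u))) = refl

pairType-succession : ∀ u → pairType u (suc u) ≡ (0 , 0 , 1)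
pairType-succession u
  rewrite dec-false (suc (suc u) ≤? suc u) (ℕₚ.<-irrefl refl)
        | dec-false (suc (suc u) ≤? u) (ℕₚ.<-asym (ℕₚ.n<1+n u))
        | dec-true  (suc u ≟ suc u) refl = refl

pairType-oneHot : ∀ {u v} → u ≢ v → OneHot (pairType u v)
pairType-oneHot {u} {v} u≢v with ℕₚ.<-cmp u v
... | tri≈ _ u≡v _ = ⊥-elim (u≢v u≡v)
... | tri> _ _ v<u = subst OneHot (sym (pairType-descent v<u)) descentᵒ
... | tri< u<v _ _ with suc u ≟ v
...   | yes refl = subst OneHot (sym (pairType-succession u)) successionᵒ
...   | no 1+u≢v = subst OneHot (sym (pairType-jump (ℕₚ.≤∧≢⇒< u<v 1+u≢v))) jumpᵒ

ℕ→ℚ-mkℚ : ∀ k → ℕ→ℚ k ≡ mkℚ (ℤ.+ k) 0 (Coprime.sym (Coprime.1-coprimeTo k))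
ℕ→ℚ-mkℚ k = normalize-coprime (Coprime.sym (Coprime.1-coprimeTo k))

ℕ→ℚ-suc : ∀ k → ℕ→ℚ (suc k) ≡ 1ℚ + ℕ→ℚ k
ℕ→ℚ-suc k rewrite ℕ→ℚ-mkℚ k | ℕ→ℚ-mkℚ (suc k) =
  toℚᵘ-injective
    (ℚᵘ.≃-trans (ℚᵘ.*≡* cross) (ℚᵘ.≃-sym (toℚᵘ-homo-+ 1ℚ (mkℚ (ℤ.+ k) 0 (Coprime.sym (Coprime.1-coprimeTo k))))))
  where
  cross : (ℤ.+ suc k) ℤ.* (ℤ.+ 1) ≡ ((ℤ.+ 1) ℤ.* (ℤ.+ 1) ℤ.+ (ℤ.+ k) ℤ.* (ℤ.+ 1)) ℤ.* (ℤ.+ 1)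
  cross rewrite ℤₚ.*-identityʳ (ℤ.+ k) = refl

*-suc-pred : ∀ k (f : ℕ → ℚ) → ℕ→ℚ k * f (suc (k ∸ 1)) ≡ ℕ→ℚ k * f k
*-suc-pred zero    f = trans (*-zeroˡ (f 1)) (sym (*-zeroˡ (f 0)))
*-suc-pred (suc k) f = refl

Weight : Set
Weight = ℕ → ℕ → ℕ → ℚ

at : Weight → List ℕ → ℚ
at h w = h (#jumps w) (#descents w) (#successions w)

-- at h (u ∷ v ∷ w) computes to at (shift (pairType u v) h) (v ∷ w).
shift : ℕ × ℕ × ℕ → Weight → Weight
shift (a , b , c) h j d s = h (a ℕ.+ j) (b ℕ.+ d) (c ℕ.+ s)

-- Inserting a new largest letter into a jump, a descent or a succession changes
-- (jumps, descents, successions) by (0, 1, 0), (1, 0, 0) and (1, 1, -1) respectively.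
insertInside : Weight → Weight
insertInside h j d s = ℕ→ℚ j * h j (suc d) s + (ℕ→ℚ d * h (suc j) d s + ℕ→ℚ s * h (suc j) (suc d) (s ∸ 1))

insertInside-zero : ∀ h → insertInside h 0 0 0 ≡ 0ℚ
insertInside-zero h =
  solve 3 (λ x y z → con 0ℚ :* x :+ (con 0ℚ :* y :+ con 0ℚ :* z) := con 0ℚ) refl (h 0 1 0) (h 1 0 0) (h 1 1 0)

insertInside-shift : ∀ {c} → OneHot c → ∀ h j d s →
  h (suc j) (suc d) s + insertInside (shift c h) j d s ≡ shift c (insertInside h) j d s
insertInside-shift jumpᵒ h j d s rewrite ℕ→ℚ-suc j =
  regroup (h (suc j) (suc d) s) (h (suc (suc j)) d s) (h (suc (suc j)) (suc d) (s ∸ 1)) (ℕ→ℚ j) (ℕ→ℚ d) (ℕ→ℚ s)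
  where
  regroup : ∀ A E G j d s → A + (j * A + (d * E + s * G)) ≡ (1ℚ + j) * A + (d * E + s * G)
  regroup = solve 6 (λ A E G j d s → A :+ (j :* A :+ (d :* E :+ s :* G)) := (con 1ℚ :+ j) :* A :+ (d :* E :+ s :* G)) refl
insertInside-shift descentᵒ h j d s rewrite ℕ→ℚ-suc d =
  regroup (h (suc j) (suc d) s) (h j (suc (suc d)) s) (h (suc j) (suc (suc d)) (s ∸ 1)) (ℕ→ℚ j) (ℕ→ℚ d) (ℕ→ℚ s)
  where
  regroup : ∀ A C G j d s → A + (j * C + (d * A + s * G)) ≡ j * C + ((1ℚ + d) * A + s * G)
  regroup = solve 6 (λ A C G j d s → A :+ (j :* C :+ (d :* A :+ s :* G)) := j :* C :+ ((con 1ℚ :+ d) :* A :+ s :* G)) refl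
insertInside-shift successionᵒ h j d s rewrite ℕ→ℚ-suc s | *-suc-pred s (h (suc j) (suc d)) =
  regroup (h (suc j) (suc d) s) (h j (suc d) (suc s)) (h (suc j) d (suc s)) (ℕ→ℚ j) (ℕ→ℚ d) (ℕ→ℚ s)
  where
  regroup : ∀ A C E j d s → A + (j * C + (d * E + s * A)) ≡ j * C + (d * E + (1ℚ + s) * A)
  regroup = solve 6 (λ A C E j d s → A :+ (j :* C :+ (d :* E :+ s :* A)) := j :* C :+ (d :* E :+ (con 1ℚ :+ s) :* A)) refl

insertions : ℕ → List ℕ → List (List ℕ)
insertions m []      = (m ∷ []) ∷ []
insertions m (u ∷ w) = (m ∷ u ∷ w) ∷ map (u ∷_) (insertions m w)

-- The slot that lies inside no pair: the end, where n+1 makes a jump if n is absent, or the slot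
-- right after n, where it makes a succession and the end slot stands in for the descent leaving n.
withJump withSuccession : Weight → Weight
withJump      h j d s = h (suc j) d s + insertInside h j d s
withSuccession h j d s = h j d (suc s) + insertInside h j d s

withJump-shift : ∀ {c} → OneHot c → ∀ h j d s →
  h (suc j) (suc d) s + withJump (shift c h) j d s ≡ shift c (withJump h) j d s
withJump-shift {c₁ , c₂ , c₃} c h j d s =
  trans (x∙yz≈y∙xz (h (suc j) (suc d) s) (shift _ h (suc j) d s) (insertInside (shift _ h) j d s))
        (cong₂ _+_ (cong (λ i → h i (c₂ ℕ.+ d) (c₃ ℕ.+ s)) (ℕₚ.+-suc c₁ j)) (insertInside-shift c h j d s))

withSuccession-shift : ∀ {c} → OneHot c → ∀ h j d s →
  h (suc j) (suc d) s + withSuccession (shift c h) j d s ≡ shift c (withSuccession h) j d s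
withSuccession-shift {c₁ , c₂ , c₃} c h j d s =
  trans (x∙yz≈y∙xz (h (suc j) (suc d) s) (shift _ h j d (suc s)) (insertInside (shift _ h) j d s))
        (cong₂ _+_ (cong (h (c₁ ℕ.+ j) (c₂ ℕ.+ d)) (ℕₚ.+-suc c₃ s)) (insertInside-shift c h j d s))

∑-insertions-∷ : ∀ h m u v w → ∑ (at h ∘ (u ∷_)) (insertions m (v ∷ w)) ≡
  at h (u ∷ m ∷ v ∷ w) + ∑ (at (shift (pairType u v) h) ∘ (v ∷_)) (insertions m w)
∑-insertions-∷ h m u v w = cong (at h (u ∷ m ∷ v ∷ w) +_) (∑-map (at h ∘ (u ∷_)) (v ∷_) (insertions m w))

∑-insertions-step : (W : Weight → Weight) →
  (∀ {c} → OneHot c → ∀ h j d s → h (suc j) (suc d) s + W (shift c h) j d s ≡ shift c (W h) j d s) →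
  ∀ h m u v w → pairType u m ≡ (1 , 0 , 0) → pairType m v ≡ (0 , 1 , 0) → u ≢ v →
  ∑ (at (shift (pairType u v) h) ∘ (v ∷_)) (insertions m w) ≡ at (W (shift (pairType u v) h)) (v ∷ w) →
  ∑ (at h ∘ (u ∷_)) (insertions m (v ∷ w)) ≡ at (W h) (u ∷ v ∷ w)
∑-insertions-step W W-shift h m u v w um-jump mv-descent u≢v ih =
  trans (∑-insertions-∷ h m u v w)
  (trans (cong₂ _+_ (cong₂ (λ a b → at (shift b (shift a h)) (v ∷ w)) um-jump mv-descent) ih)
         (W-shift (pairType-oneHot u≢v) h (#jumps (v ∷ w)) (#descents (v ∷ w)) (#successions (v ∷ w))))

∑-insertions-[] : ∀ h u v → ∑ (at h ∘ (u ∷_)) (insertions v []) ≡ shift (pairType u v) h 0 0 0 + insertInside h 0 0 0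
∑-insertions-[] h u v = cong (shift (pairType u v) h 0 0 0 +_) (sym (insertInside-zero h))

∑-insertions-withoutMax : ∀ {n} h u w → All (_< n) (u ∷ w) → Unique (u ∷ w) →
  ∑ (at h ∘ (u ∷_)) (insertions (suc n) w) ≡ at (withJump h) (u ∷ w)
∑-insertions-withoutMax h u [] (u<n ∷ []) _ =
  trans (∑-insertions-[] h u _) (cong (λ c → shift c h 0 0 0 + _) (pairType-jump (s≤s u<n)))
∑-insertions-withoutMax h u (v ∷ w) (u<n ∷ below@(v<n ∷ _)) ((u≢v ∷ _) ∷ distinct) =
  ∑-insertions-step withJump withJump-shift h (suc _) u v w
    (pairType-jump (s≤s u<n)) (pairType-descent (s≤s (ℕₚ.<⇒≤ v<n))) u≢v
    (∑-insertions-withoutMax (shift (pairType u v) h) v w below distinct)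

withSuccession-afterMax : ∀ {a b c} → a ≡ (0 , 0 , 1) → b ≡ (0 , 1 , 0) → c ≡ (0 , 1 , 0) → ∀ h j d s →
  shift b (shift a h) j d s + withJump (shift c h) j d s ≡ shift c (withSuccession h) j d s
withSuccession-afterMax refl refl refl h j d s = cong (h j (suc d) (suc s) +_) (insertInside-shift descentᵒ h j d s)

∑-insertions-withMax : ∀ {n} h u w → All (_≤ n) (u ∷ w) → Unique (u ∷ w) → n ∈ u ∷ w →
  ∑ (at h ∘ (u ∷_)) (insertions (suc n) w) ≡ at (withSuccession h) (u ∷ w)
∑-insertions-withMax h u [] _ _ (here refl) =
  trans (∑-insertions-[] h u _) (cong (λ c → shift c h 0 0 0 + _) (pairType-succession u))
∑-insertions-withMax {n} h u (v ∷ w) (u≤n ∷ rest@(v≤n ∷ _)) ((u≢v ∷ u∉w) ∷ distinct) n∈ with u ≟ n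
... | yes refl =
  trans (∑-insertions-∷ h (suc u) u v w)
  (trans (cong (at h (u ∷ suc u ∷ v ∷ w) +_) (∑-insertions-withoutMax (shift (pairType u v) h) v w below distinct))
         (withSuccession-afterMax (pairType-succession u) (pairType-descent (s≤s v≤n)) (pairType-descent (All.head below))
            h (#jumps (v ∷ w)) (#descents (v ∷ w)) (#successions (v ∷ w))))
  where
  below : All (_< u) (v ∷ w)
  below = All.zipWith (λ (x≤u , u≢x) → ℕₚ.≤∧≢⇒< x≤u (u≢x ∘ sym)) (rest , u≢v ∷ u∉w)
... | no u≢n with n∈
...   | here n≡u  = ⊥-elim (u≢n (sym n≡u))
...   | there n∈w =
  ∑-insertions-step withSuccession withSuccession-shift h (suc n) u v w
    (pairType-jump (s≤s (ℕₚ.≤∧≢⇒< u≤n u≢n))) (pairType-descent (s≤s v≤n)) u≢v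
    (∑-insertions-withMax (shift (pairType u v) h) v w rest distinct n∈w)

startsWithOne : List ℕ → ℕ
startsWithOne []      = 0
startsWithOne (s ∷ _) = if eqℕ 1 s then 1 else 0

monomial : List ℕ → Mono
monomial σ = 1 , startsWithOne σ , jump σ , des σ , sucs σ

-- at (monomialWeight g s) (s ∷ τ) computes to g (monomial (s ∷ τ)).
monomialWeight : (Mono → ℚ) → ℕ → Weight
monomialWeight g s j d t = g (1 , startsWithOne (s ∷ []) , indicator (isJump 0 s) ℕ.+ j , d , t)

monomial-insertFront : ∀ n s σ → s ≤ suc n →
  monomial (suc (suc n) ∷ s ∷ σ) ≡ (1 , 0 , suc (#jumps (s ∷ σ)) , suc (#descents (s ∷ σ)) , #successions (s ∷ σ))
monomial-insertFront n s σ s≤1+n =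
  cong (λ { (a , b , c) → 1 , 0 , suc (a ℕ.+ #jumps (s ∷ σ)) , b ℕ.+ #descents (s ∷ σ) , c ℕ.+ #successions (s ∷ σ) })
       (pairType-descent (s≤s s≤1+n))

Dᵀ-monomialWeight : ∀ g s → 1 ≤ s → ∀ j d t →
  Dᵀ g (1 , startsWithOne (s ∷ []) , indicator (isJump 0 s) ℕ.+ j , d , t)
    ≡ g (1 , 0 , suc j , suc d , t) + withSuccession (monomialWeight g s) j d t
Dᵀ-monomialWeight g (suc zero) _ j d t
  rewrite *-suc-pred j (λ i → g (1 , 1 , i , suc d , t)) | *-suc-pred d (λ i → g (1 , 1 , suc j , i , t)) =
  regroup (g (1 , 1 , j , d , suc t)) (g (1 , 0 , suc j , suc d , t)) (g (1 , 1 , j , suc d , t))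
          (g (1 , 1 , suc j , d , t)) (g (1 , 1 , suc j , suc d , t ∸ 1)) (ℕ→ℚ j) (ℕ→ℚ d) (ℕ→ℚ t)
  where
  regroup : ∀ A B C E G j d t → 1ℚ * A + (1ℚ * B + (j * C + (d * E + t * G))) ≡ B + (A + (j * C + (d * E + t * G)))
  regroup = solve 8 (λ A B C E G j d t →
    con 1ℚ :* A :+ (con 1ℚ :* B :+ (j :* C :+ (d :* E :+ t :* G))) := B :+ (A :+ (j :* C :+ (d :* E :+ t :* G)))) refl
Dᵀ-monomialWeight g (suc (suc k)) _ j d t
  rewrite ℕ→ℚ-suc j | *-suc-pred d (λ i → g (1 , 0 , suc (suc j) , i , t)) =
  regroup (g (1 , 0 , suc j , suc d , t)) (g (1 , 0 , suc j , d , suc t)) (g (1 , 0 , suc (suc j) , suc d , t))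
          (g (1 , 0 , suc (suc j) , d , t)) (g (1 , 0 , suc (suc j) , suc d , t ∸ 1)) (ℕ→ℚ j) (ℕ→ℚ d) (ℕ→ℚ t)
  where
  regroup : ∀ A B X E G j d t → 1ℚ * B + (0ℚ * X + ((1ℚ + j) * A + (d * E + t * G))) ≡ A + (B + (j * A + (d * E + t * G)))
  regroup = solve 8 (λ A B X E G j d t →
    con 1ℚ :* B :+ (con 0ℚ :* X :+ ((con 1ℚ :+ j) :* A :+ (d :* E :+ t :* G))) := A :+ (B :+ (j :* A :+ (d :* E :+ t :* G)))) refl

∑-monomial-insertions : ∀ {n} g s σ → All (_≤ suc n) (s ∷ σ) → Unique (s ∷ σ) → suc n ∈ s ∷ σ →
  ∑ (g ∘ monomial) (insertions (suc (suc n)) (s ∷ σ))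
    ≡ g (1 , 0 , suc (#jumps (s ∷ σ)) , suc (#descents (s ∷ σ)) , #successions (s ∷ σ))
      + at (withSuccession (monomialWeight g s)) (s ∷ σ)
∑-monomial-insertions {n} g s σ bounded@(s≤1+n ∷ _) distinct max∈ =
  cong₂ _+_ (cong g (monomial-insertFront n s σ s≤1+n))
            (trans (∑-map (g ∘ monomial) (s ∷_) (insertions (suc (suc n)) σ))
                   (∑-insertions-withMax (monomialWeight g s) s σ bounded distinct max∈))

Dᵀ-monomial : ∀ {n} g s σ → 1 ≤ s → All (_≤ suc n) (s ∷ σ) → Unique (s ∷ σ) → suc n ∈ s ∷ σ →
  Dᵀ g (monomial (s ∷ σ)) ≡ ∑ (g ∘ monomial) (insertions (suc (suc n)) (s ∷ σ))
Dᵀ-monomial g s σ 1≤s bounded distinct max∈ =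
  trans (Dᵀ-monomialWeight g s 1≤s (#jumps (s ∷ σ)) (#descents (s ∷ σ)) (#successions (s ∷ σ)))
        (sym (∑-monomial-insertions g s σ bounded distinct max∈))

Unique-resp-↭ : {A : Set} {xs ys : List A} → xs ↭ ys → Unique xs → Unique ys
Unique-resp-↭ p = ↭ₛ.Unique-resp-↭ (setoid _) (↭⇒↭ₛ p)

concatMap-unique : {A B : Set} (f : A → List B) (r : B → A) {xs : List A} → Unique xs →
  All (λ x → Unique (f x) × (∀ {y} → y ∈ f x → r y ≡ x)) xs → Unique (concatMap f xs)
concatMap-unique f r {[]}     _                 _                         = []
concatMap-unique f r {x ∷ xs} (x∉xs ∷ distinct) ((fx-unique , r∘fx) ∷ rest) =
  Unique.++⁺ fx-unique (concatMap-unique f r distinct rest) disjoint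
  where
  disjoint : ∀ {y} → y ∈ f x × y ∈ concatMap f xs → ⊥
  disjoint (y∈fx , y∈rest) with find (∈-concatMap⁻ f {xs = xs} y∈rest)
  ... | x′ , x′∈xs , y∈fx′ =
    All¬⇒¬Any x∉xs (subst (_∈ xs) (trans (sym (proj₂ (All.lookup rest x′∈xs) y∈fx′)) (r∘fx y∈fx)) x′∈xs)

InRange : ℕ → ℕ → Set
InRange n x = 1 ≤ x × x ≤ n

IsPermutation : ℕ → List ℕ → Set
IsPermutation n τ = length τ ≡ n × All (InRange n) τ × Unique τ

∈-words⁻ : ∀ k n {τ} → τ ∈ words k n → length τ ≡ k × All (InRange n) τ
∈-words⁻ zero    n (here refl) = refl , []
∈-words⁻ (suc k) n τ∈ with find (∈-concatMap⁻ (λ w → map (λ i → suc i ∷ w) (upTo n)) {xs = words k n} τ∈)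
... | w , w∈ , τ∈′ with ∈-map⁻ (λ i → suc i ∷ w) τ∈′
... | i , i∈ , refl with ∈-words⁻ k n w∈
... | length≡ , inRange = cong suc length≡ , (s≤s z≤n , ∈-upTo⁻ i∈) ∷ inRange

∈-words⁺ : ∀ k n τ → length τ ≡ k → All (InRange n) τ → τ ∈ words k n
∈-words⁺ zero    n []          _       _ = here refl
∈-words⁺ (suc k) n (suc i ∷ τ) length≡ ((_ , i<n) ∷ inRange) =
  ∈-concatMap⁺ (λ w → map (λ i → suc i ∷ w) (upTo n))
    (lose (∈-words⁺ k n τ (ℕₚ.suc-injective length≡) inRange) (∈-map⁺ (λ j → suc j ∷ τ) (∈-upTo⁺ i<n)))

words-unique : ∀ k n → Unique (words k n)
words-unique zero    n = [] ∷ []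
words-unique (suc k) n =
  concatMap-unique _ tail (words-unique k n)
    (All.tabulate λ {w} _ → Unique.map⁺ (λ { refl → refl }) (Unique.upTo⁺ n) , tail-prepend w)
  where
  tail : List ℕ → List ℕ
  tail []      = []
  tail (_ ∷ τ) = τ
  tail-prepend : ∀ w {τ} → τ ∈ map (λ i → suc i ∷ w) (upTo n) → tail τ ≡ w
  tail-prepend w τ∈ with ∈-map⁻ (λ i → suc i ∷ w) τ∈
  ... | _ , _ , refl = refl

∈-S⁻ : ∀ n {τ} → τ ∈ S n → IsPermutation n τ
∈-S⁻ n τ∈ with ∈-filter⁻ unique? {xs = words n n} τ∈
... | τ∈words , distinct with ∈-words⁻ n n τ∈words
... | length≡ , inRange = length≡ , inRange , distinct

∈-S⁺ : ∀ n {τ} → IsPermutation n τ → τ ∈ S n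
∈-S⁺ n {τ} (length≡ , inRange , distinct) = ∈-filter⁺ unique? (∈-words⁺ n n τ length≡ inRange) distinct

S-unique : ∀ n → Unique (S n)
S-unique n = Unique.filter⁺ unique? (words-unique n n)

insertions-↭ : ∀ m σ {τ} → τ ∈ insertions m σ → τ ↭ m ∷ σ
insertions-↭ m []      (here refl) = ↭.refl
insertions-↭ m (u ∷ w) (here refl) = ↭.refl
insertions-↭ m (u ∷ w) (there τ∈) with ∈-map⁻ (u ∷_) τ∈
... | τ , τ∈′ , refl = ↭.trans (↭.prep u (insertions-↭ m w τ∈′)) (↭.swap u m ↭.refl)

∈-insertions : ∀ m xs ys → xs ++ m ∷ ys ∈ insertions m (xs ++ ys)
∈-insertions m []       []       = here refl
∈-insertions m []       (y ∷ ys) = here refl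
∈-insertions m (x ∷ xs) ys       = there (∈-map⁺ (x ∷_) (∈-insertions m xs ys))

insertions-unique : ∀ m σ → m ∉ σ → Unique (insertions m σ)
insertions-unique m []      _   = [] ∷ []
insertions-unique m (u ∷ w) m∉ =
  Allₚ.map⁺ (All.tabulate λ _ m∷u∷w≡u∷τ → m∉ (here (cong head m∷u∷w≡u∷τ)))
  ∷ Unique.map⁺ (λ { refl → refl }) (insertions-unique m w (m∉ ∘ there))
  where
  head : List ℕ → ℕ
  head []      = 0
  head (x ∷ _) = x

remove : ℕ → List ℕ → List ℕ
remove m []      = []
remove m (x ∷ xs) with x ℕ.≟ m
... | yes _ = xs
... | no  _ = x ∷ remove m xs

remove-head : ∀ m xs → remove m (m ∷ xs) ≡ xs
remove-head m xs with m ℕ.≟ m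
... | yes _   = refl
... | no  m≢m = ⊥-elim (m≢m refl)

remove-insertions : ∀ m σ → m ∉ σ → ∀ {τ} → τ ∈ insertions m σ → remove m τ ≡ σ
remove-insertions m []      _  (here refl) = remove-head m []
remove-insertions m (u ∷ w) _  (here refl) = remove-head m (u ∷ w)
remove-insertions m (u ∷ w) m∉ (there τ∈) with ∈-map⁻ (u ∷_) τ∈
... | τ , τ∈′ , refl with u ℕ.≟ m
... | yes u≡m = ⊥-elim (m∉ (here (sym u≡m)))
... | no  _   = cong (u ∷_) (remove-insertions m w (m∉ ∘ there) τ∈′)

InRange-pred : ∀ {n xs} → All (InRange (suc n)) xs → All (suc n ≢_) xs → All (InRange n) xs
InRange-pred inRange 1+n∉ =
  All.zipWith (λ ((1≤x , x≤1+n) , 1+n≢x) → 1≤x , ℕₚ.≤-pred (ℕₚ.≤∧≢⇒< x≤1+n (1+n≢x ∘ sym))) (inRange , 1+n∉)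

pigeonhole : ∀ n xs → Unique xs → All (InRange n) xs → length xs ≤ n
pigeonhole zero    []       _ _                  = z≤n
pigeonhole zero    (x ∷ xs) _ ((1≤x , x≤0) ∷ _) = ⊥-elim (ℕₚ.<-irrefl refl (ℕₚ.≤-trans 1≤x x≤0))
pigeonhole (suc n) xs distinct inRange with suc n ∈? xs
... | no  1+n∉xs = ℕₚ.m≤n⇒m≤1+n (pigeonhole n xs distinct (InRange-pred inRange (¬Any⇒All¬ xs 1+n∉xs)))
... | yes 1+n∈xs with ∈-∃++ 1+n∈xs
... | ys , zs , refl with Unique-resp-↭ (↭ₚ.shift (suc n) ys zs) distinct | ↭ₚ.All-resp-↭ (↭ₚ.shift (suc n) ys zs) inRange
... | 1+n∉ ∷ distinct′ | _ ∷ inRange′ =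
  subst (_≤ suc n) (sym (↭ₚ.↭-length (↭ₚ.shift (suc n) ys zs)))
        (s≤s (pigeonhole n (ys ++ zs) distinct′ (InRange-pred inRange′ 1+n∉)))

max∈permutation : ∀ n {τ} → IsPermutation (suc n) τ → suc n ∈ τ
max∈permutation n {τ} (length≡ , inRange , distinct) with suc n ∈? τ
... | yes 1+n∈τ = 1+n∈τ
... | no  1+n∉τ = ⊥-elim (ℕₚ.<-irrefl refl
  (subst (_≤ n) length≡ (pigeonhole n τ distinct (InRange-pred inRange (¬Any⇒All¬ τ 1+n∉τ)))))

max∉permutation : ∀ {n σ} → All (InRange n) σ → suc n ∉ σ
max∉permutation inRange = All¬⇒¬Any (All.map (λ (_ , x≤n) 1+n≡x → ℕₚ.<-irrefl (sym 1+n≡x) (s≤s x≤n)) inRange)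

insert-permutation : ∀ n {σ τ} → IsPermutation n σ → τ ∈ insertions (suc n) σ → IsPermutation (suc n) τ
insert-permutation n {σ} (length≡ , inRange , distinct) τ∈ =
    trans (↭ₚ.↭-length τ↭) (cong suc length≡)
  , ↭ₚ.All-resp-↭ (↭-sym τ↭)
      ((s≤s z≤n , ℕₚ.≤-refl) ∷ All.map (λ (1≤x , x≤n) → 1≤x , ℕₚ.m≤n⇒m≤1+n x≤n) inRange)
  , Unique-resp-↭ (↭-sym τ↭) (¬Any⇒All¬ σ (max∉permutation inRange) ∷ distinct)
  where τ↭ = insertions-↭ (suc n) σ τ∈

remove-max : ∀ n {τ} → IsPermutation (suc n) τ → ∃ λ σ → IsPermutation n σ × τ ∈ insertions (suc n) σ
remove-max n {τ} perm@(length≡ , inRange , distinct) with ∈-∃++ (max∈permutation n perm)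
... | xs , ys , refl with Unique-resp-↭ (↭ₚ.shift (suc n) xs ys) distinct | ↭ₚ.All-resp-↭ (↭ₚ.shift (suc n) xs ys) inRange
... | 1+n∉ ∷ distinct′ | _ ∷ inRange′ =
    xs ++ ys
  , ( ℕₚ.suc-injective (trans (sym (↭ₚ.↭-length (↭ₚ.shift (suc n) xs ys))) length≡)
    , InRange-pred inRange′ 1+n∉
    , distinct′ )
  , ∈-insertions (suc n) xs ys

∑-S-suc : ∀ (f : List ℕ → ℚ) n → ∑ f (S (suc n)) ≡ ∑ (λ σ → ∑ f (insertions (suc n) σ)) (S n)
∑-S-suc f n =
  trans (∑-sameElements f (S-unique (suc n)) inserted-unique from-S to-S) (∑-concatMap f (insertions (suc n)) (S n))
  where
  inserted-unique : Unique (concatMap (insertions (suc n)) (S n))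
  inserted-unique = concatMap-unique (insertions (suc n)) (remove (suc n)) (S-unique n)
    (All.tabulate λ {σ} σ∈ → let (_ , inRange , _) = ∈-S⁻ n σ∈ in
       insertions-unique (suc n) σ (max∉permutation inRange) , remove-insertions (suc n) σ (max∉permutation inRange))
  from-S : ∀ {τ} → τ ∈ S (suc n) → τ ∈ concatMap (insertions (suc n)) (S n)
  from-S τ∈ with remove-max n (∈-S⁻ (suc n) τ∈)
  ... | σ , perm , τ∈′ = ∈-concatMap⁺ (insertions (suc n)) (lose (∈-S⁺ n perm) τ∈′)
  to-S : ∀ {τ} → τ ∈ concatMap (insertions (suc n)) (S n) → τ ∈ S (suc n)
  to-S τ∈ with find (∈-concatMap⁻ (insertions (suc n)) {xs = S n} τ∈)
  ... | σ , σ∈ , τ∈′ = ∈-S⁺ (suc n) (insert-permutation n (∈-S⁻ n σ∈) τ∈′)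

Dᵀ-monomial-permutation : ∀ n g {σ} → σ ∈ S (suc n) →
  Dᵀ g (monomial σ) ≡ ∑ (g ∘ monomial) (insertions (suc (suc n)) σ)
Dᵀ-monomial-permutation n g {σ} σ∈ with ∈-S⁻ (suc n) σ∈
Dᵀ-monomial-permutation n g {s ∷ σ} σ∈ | perm@(_ , inRange@((1≤s , _) ∷ _) , distinct) =
  Dᵀ-monomial g s σ 1≤s (All.map proj₂ inRange) distinct (max∈permutation n perm)

⟦⟧-iterate-D : ∀ n g → ⟦ g ⟧ (iterate D n (var-a ⊗ var-b)) ≡ ∑ (g ∘ monomial) (S (suc n))
⟦⟧-iterate-D zero    g = cong (_+ 0ℚ) (*-identityˡ (g (1 , 1 , 0 , 0 , 0)))
⟦⟧-iterate-D (suc n) g = begin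
  ⟦ g ⟧ (D (iterate D n (var-a ⊗ var-b)))                              ≡⟨ ⟦⟧-D g (iterate D n (var-a ⊗ var-b)) ⟩
  ⟦ Dᵀ g ⟧ (iterate D n (var-a ⊗ var-b))                               ≡⟨ ⟦⟧-iterate-D n (Dᵀ g) ⟩
  ∑ (Dᵀ g ∘ monomial) (S (suc n))                                      ≡⟨ ∑-cong (S (suc n)) (Dᵀ-monomial-permutation n g) ⟩
  ∑ (λ σ → ∑ (g ∘ monomial) (insertions (suc (suc n)) σ)) (S (suc n)) ≡⟨ ∑-S-suc (g ∘ monomial) (suc n) ⟨
  ∑ (g ∘ monomial) (S (suc (suc n)))                                   ∎
  where open ≡-Reasoning

coeff3-statistics : ∀ μ σs →
  coeff3 (map (λ σ → (1ℚ , (jump σ , des σ , sucs σ))) σs) μ ≡ ∑ (δ-xyz μ ∘ monomial) σs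
coeff3-statistics μ []       = refl
coeff3-statistics μ (σ ∷ σs) = cong (δ-xyz μ (monomial σ) +_) (coeff3-statistics μ σs)

theorem3p6 : (n : ℕ) → 1 ≤ n → (μ : Mono3) →
    coeff3 (R n) μ ≡ coeff3 (eval-a1b1 (iterate D (n ∸ 1) (var-a ⊗ var-b))) μ
theorem3p6 (suc n) _ μ = begin
  coeff3 (R (suc n)) μ                               ≡⟨ coeff3-statistics μ (S (suc n)) ⟩
  ∑ (δ-xyz μ ∘ monomial) (S (suc n))                 ≡⟨ ⟦⟧-iterate-D n (δ-xyz μ) ⟨
  ⟦ δ-xyz μ ⟧ (iterate D n (var-a ⊗ var-b))          ≡⟨ coeff3-eval-a1b1 (iterate D n (var-a ⊗ var-b)) μ ⟨
  coeff3 (eval-a1b1 (iterate D n (var-a ⊗ var-b))) μ ∎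
  where open ≡-Reasoning
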